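{- For any integer $r\ge3$, the set $\Phi_r^*$ is infinite.
   Context: $\Phi_r$ is the set of $r$-connected $r$-regular graphs of class 1 (edge chromatic number equal to maximum degree). $\Phi_r^*$ is the set of graphs $G\in\Phi_r$ such that $G-w$ is not bipartite for every vertex $w$ of $G$. -}

module Defs where

open import Data.Nat using (ℕ; zero; suc; _+_; _<_; _⊔_)
open import Data.Bool using (Bool; true; false; T; if_then_else_)
open import Data.Fin using (Fin; zero; suc)
open import Data.Fin.Subset using (Subset; _∉_; ∣_∣)
open import Data.Product using (Σ; _×_; ∃)
open import Relation.Binary.PropositionalEquality using (_≡_; _≢_)
open import Relation.Nullary using (¬_)

record Graph : Set where
  field
    n      : ℕ
    adj    : Fin n → Fin n → Bool
    sym    : ∀ u v → adj u v ≡ adj v u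
    irrefl : ∀ v → adj v v ≡ false
open Graph public

Adj : (G : Graph) → Fin (n G) → Fin (n G) → Set
Adj G u v = T (adj G u v)

count : ∀ {k} → (Fin k → Bool) → ℕ
count {zero}  f = 0
count {suc k} f = (if f zero then 1 else 0) + count (λ i → f (suc i))

maxFin : ∀ {k} → (Fin k → ℕ) → ℕ
maxFin {zero}  f = 0
maxFin {suc k} f = f zero ⊔ maxFin (λ i → f (suc i))

degree : (G : Graph) → Fin (n G) → ℕ
degree G v = count (adj G v)

maxDegree : Graph → ℕ
maxDegree G = maxFin (degree G)

Regular : ℕ → Graph → Set
Regular r G = ∀ v → degree G v ≡ r

data Reach (G : Graph) (P : Fin (n G) → Set) : Fin (n G) → Fin (n G) → Set where
  here  : ∀ {u} → P u → Reach G P u u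
  there : ∀ {u v w} → P u → Adj G u v → Reach G P v w → Reach G P u w

ConnectedOn : (G : Graph) → (Fin (n G) → Set) → Set
ConnectedOn G P = ∀ u v → P u → P v → Reach G P u v

KConnected : ℕ → Graph → Set
KConnected k G =
  (k < n G) × (∀ (S : Subset (n G)) → ∣ S ∣ < k → ConnectedOn G (λ v → v ∉ S))

EdgeColourable : ℕ → Graph → Set
EdgeColourable k G =
  Σ (Fin (n G) → Fin (n G) → Fin k) λ c →
    (∀ u v → Adj G u v → c u v ≡ c v u) ×
    (∀ v u w → Adj G v u → Adj G v w → u ≢ w → c v u ≢ c v w)

-- class 1: edge chromatic number equals maximum degree.  Since every
-- proper edge colouring needs at least Δ colours, this is Δ-edge-colourability.
Class1 : Graph → Set
Class1 G = EdgeColourable (maxDegree G) G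

BipartiteOn : (G : Graph) → (Fin (n G) → Set) → Set
BipartiteOn G P =
  Σ (Fin (n G) → Bool) λ f → ∀ u v → P u → P v → Adj G u v → f u ≢ f v

DeleteBipartite : (G : Graph) → Fin (n G) → Set
DeleteBipartite G w = BipartiteOn G (λ v → v ≢ w)

InΦ : ℕ → Graph → Set
InΦ r G = KConnected r G × Regular r G × Class1 G

InΦ* : ℕ → Graph → Set
InΦ* r G = InΦ r G × (∀ w → ¬ DeleteBipartite G w)

-- An odd cycle is 2-connected, 2-regular and not bipartite, and although it is not class 1 it
-- has a proper 3-edge-colouring in which every vertex misses some colour.  The prism G □ K₂
-- (two copies of G joined by the perfect matching of rungs) raises connectivity and degree by
-- one, and after deleting any vertex it still contains a copy of G, so it stays non-bipartite.
-- Colouring both copies as in G and each rung by the colour missing at its ends colours the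
-- prism with Δ(G) + 1 = Δ(prism) colours, so the prism is class 1; one extra colour then again
-- leaves a colour missing everywhere.  Starting from the cycle on 2t + 3 vertices and taking
-- the prism r − 2 times therefore yields a member of Φ*_r with more than t vertices.

module Submission where

open import Defs hiding (sym)
open import Data.Bool using (Bool; true; false; T; not; if_then_else_; _∨_)
open import Data.Bool.Properties using (∨-comm; T-∨; not-involutive; ¬-not)
open import Data.Empty using (⊥-elim)
open import Data.Fin using (Fin; zero; suc; toℕ; fromℕ; fromℕ<; inject₁; _↑ˡ_; _↑ʳ_; splitAt; join)
import Data.Fin.Properties as Fin
open import Data.Fin.Properties
  using ( toℕ-injective; toℕ-fromℕ<; toℕ<n; splitAt-↑ˡ; splitAt-↑ʳ; join-splitAt
        ; fromℕ≢inject₁; inject₁-injective; ¬∀⟶∃¬ )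
  renaming (_≟_ to _≟ᶠ_)
open import Data.Fin.Subset using (Subset; _∈_; _∉_; ∣_∣; _∪_; ⊤)
open import Data.Fin.Subset.Properties
  using (x∈p⇒∣p-x∣<∣p∣; x∈p∧x≢y⇒x∈p-y; ∣⊤∣≡n; ∣p∣≤∣x∷p∣; p⊆q⇒∣p∣≤∣q∣; nonempty?; x∈p∪q⁺; _∈?_)
import Data.Nat as ℕ
open import Data.Nat using (ℕ; zero; suc; _+_; _∸_; _⊔_; _<_; _≤_; z≤n; s≤s; _<?_)
open import Data.Nat.Properties
  using ( +-suc; +-comm; +-assoc; +-identityʳ; +-monoʳ-≤; +-cancelˡ-≤; ⊔-idem; ⊔-identityʳ
        ; ≤-refl; ≤-reflexive; ≤-trans; ≤-<-trans; <-≤-trans; <-irrefl; ≤-total; ≤-pred; ≮⇒≥; ≤∧≢⇒<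
        ; n≤0⇒n≡0; n<1+n; n≤1+n; m≤m+n; m≤n+m; m∸n+n≡m; module ≤-Reasoning )
open import Data.Product using (Σ; _×_; _,_; proj₁)
open import Data.Sum using (_⊎_; inj₁; inj₂)
import Data.Sum as Sum
open import Data.Unit using (tt) renaming (⊤ to Unit)
open import Data.Vec using ([]; _∷_; _++_; lookup)
import Data.Vec as Vec
open import Data.Vec.Properties using (lookup-++ˡ; lookup-++ʳ; []=⇒lookup; lookup⇒[]=)
open import Function using (_∘_; id)
open import Function.Bundles using (Equivalence)
open import Relation.Binary.PropositionalEquality
  using (_≡_; _≢_; refl; sym; trans; cong; cong₂; subst; subst₂; module ≡-Reasoning)
open import Relation.Nullary using (¬_; Dec; yes; no)
open import Relation.Nullary.Decidable using (⌊_⌋; toWitness; fromWitness; dec-false; isYes≗does)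

module _ {G : Graph} where

  Adj-sym : ∀ {u v} → Adj G u v → Adj G v u
  Adj-sym {u} {v} = subst T (Graph.sym G u v)

  module _ {P : Fin (n G) → Set} where

    Reach-source : ∀ {u v} → Reach G P u v → P u
    Reach-source (here p)      = p
    Reach-source (there p _ _) = p

    Reach-trans : ∀ {u v w} → Reach G P u v → Reach G P v w → Reach G P u w
    Reach-trans (here _)      q = q
    Reach-trans (there p a r) q = there p a (Reach-trans r q)

    Reach-sym : ∀ {u v} → Reach G P u v → Reach G P v u
    Reach-sym (here p)      = here p
    Reach-sym (there p a r) = Reach-trans (Reach-sym r) (there (Reach-source r) (Adj-sym a) (here p))

ConnectedOn-hub : ∀ {G P} h → (∀ x → P x → Reach G P x h) → ConnectedOn G P
ConnectedOn-hub h reach x y px py = Reach-trans (reach x px) (Reach-sym (reach y py))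

Reach-map : ∀ {G H : Graph} {P : Fin (n G) → Set} {Q : Fin (n H) → Set}
  (f : Fin (n G) → Fin (n H)) → (∀ {x} → P x → Q (f x)) → (∀ {x y} → Adj G x y → Adj H (f x) (f y)) →
  ∀ {u v} → Reach G P u v → Reach H Q (f u) (f v)
Reach-map f pq adj-f (here p)      = here (pq p)
Reach-map f pq adj-f (there p a r) = there (pq p) (adj-f a) (Reach-map f pq adj-f r)

count-cong : ∀ {k} {f g : Fin k → Bool} → (∀ i → f i ≡ g i) → count f ≡ count g
count-cong {zero}  f≗g = refl
count-cong {suc k} f≗g = cong₂ _+_ (cong (λ b → if b then 1 else 0) (f≗g zero)) (count-cong (f≗g ∘ suc))

count-↑ : ∀ m {k} (f : Fin (m + k) → Bool) → count f ≡ count (f ∘ (_↑ˡ k)) + count (f ∘ (m ↑ʳ_))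
count-↑ zero    f = refl
count-↑ (suc m) f =
  trans (cong (head +_) (count-↑ m (f ∘ suc))) (sym (+-assoc head _ _))
  where head = if f zero then 1 else 0

count-none : ∀ {k} (f : Fin k → Bool) → (∀ i → ¬ T (f i)) → count f ≡ 0
count-none {zero}  f none = refl
count-none {suc k} f none with f zero | none zero
... | false | _   = count-none (f ∘ suc) (none ∘ suc)
... | true  | ¬f0 = ⊥-elim (¬f0 tt)

count-unique : ∀ {k} (f : Fin k → Bool) a → T (f a) → (∀ i → T (f i) → i ≡ a) → count f ≡ 1
count-unique f zero fa unique with f zero
... | true  = cong suc (count-none (f ∘ suc) (λ i fi → Fin.0≢1+n (sym (unique (suc i) fi))))
count-unique f (suc a) fa unique with f zero | unique zero
... | false | _ = count-unique (f ∘ suc) a fa (λ i fi → Fin.suc-injective (unique (suc i) fi))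
... | true  | u0 = ⊥-elim (Fin.0≢1+n (u0 tt))

count-≟ : ∀ {k} (u : Fin k) → count (λ v → ⌊ u ≟ᶠ v ⌋) ≡ 1
count-≟ u = count-unique _ u (fromWitness refl) (λ v u≡v → sym (toWitness u≡v))

count-unique-toℕ : ∀ {k} {R : ℕ → Set} (R? : ∀ j → Dec (R j)) j → j < k → R j →
  (∀ j′ → j′ < k → R j′ → j′ ≡ j) → count {k} (λ v → ⌊ R? (toℕ v) ⌋) ≡ 1
count-unique-toℕ {R = R} R? j j<k Rj unique = count-unique _ (fromℕ< j<k)
  (fromWitness (subst R (sym (toℕ-fromℕ< j<k)) Rj))
  (λ v Rv → toℕ-injective (trans (unique (toℕ v) (toℕ<n v) (toWitness Rv)) (sym (toℕ-fromℕ< j<k))))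

count-∨ : ∀ {k} (f g : Fin k → Bool) → (∀ i → T (f i) → ¬ T (g i)) →
  count (λ i → f i ∨ g i) ≡ count f + count g
count-∨ {zero}  f g disjoint = refl
count-∨ {suc k} f g disjoint with f zero | g zero | disjoint zero
... | true  | true  | d = ⊥-elim (d tt tt)
... | true  | false | _ = cong suc (count-∨ (f ∘ suc) (g ∘ suc) (disjoint ∘ suc))
... | false | true  | _ = trans (cong suc (count-∨ (f ∘ suc) (g ∘ suc) (disjoint ∘ suc))) (sym (+-suc _ _))
... | false | false | _ = count-∨ (f ∘ suc) (g ∘ suc) (disjoint ∘ suc)

m+n≤o≤m⇒n≡0 : ∀ {m n o} → m + n ≤ o → o ≤ m → n ≡ 0
m+n≤o≤m⇒n≡0 {m} {n} m+n≤o o≤m =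
  n≤0⇒n≡0 (+-cancelˡ-≤ m n 0 (≤-trans m+n≤o (≤-trans o≤m (≤-reflexive (sym (+-identityʳ m))))))

x∈p⇒0<∣p∣ : ∀ {k} {p : Subset k} {x} → x ∈ p → 0 < ∣ p ∣
x∈p⇒0<∣p∣ x∈p = ≤-<-trans z≤n (x∈p⇒∣p-x∣<∣p∣ x∈p)

∣p∣≡0⇒x∉p : ∀ {k} {p : Subset k} → ∣ p ∣ ≡ 0 → ∀ x → x ∉ p
∣p∣≡0⇒x∉p ∣p∣≡0 x x∈p = <-irrefl (sym ∣p∣≡0) (x∈p⇒0<∣p∣ x∈p)

∣p∣≤1∧x∈p∧y≢x⇒y∉p : ∀ {k} {p : Subset k} → ∣ p ∣ ≤ 1 → ∀ {x y} → x ∈ p → y ≢ x → y ∉ p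
∣p∣≤1∧x∈p∧y≢x⇒y∉p ∣p∣≤1 x∈p y≢x y∈p =
  <-irrefl refl (≤-trans (s≤s (x∈p⇒0<∣p∣ (x∈p∧x≢y⇒x∈p-y y∈p y≢x))) (≤-trans (x∈p⇒∣p-x∣<∣p∣ x∈p) ∣p∣≤1))

∣p∪q∣≤∣p∣+∣q∣ : ∀ {k} (p q : Subset k) → ∣ p ∪ q ∣ ≤ ∣ p ∣ + ∣ q ∣
∣p∪q∣≤∣p∣+∣q∣ []          []          = z≤n
∣p∪q∣≤∣p∣+∣q∣ (true  ∷ p) (s     ∷ q) =
  s≤s (≤-trans (∣p∪q∣≤∣p∣+∣q∣ p q) (+-monoʳ-≤ ∣ p ∣ (∣p∣≤∣x∷p∣ s q)))
∣p∪q∣≤∣p∣+∣q∣ (false ∷ p) (true  ∷ q) =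
  ≤-trans (s≤s (∣p∪q∣≤∣p∣+∣q∣ p q)) (≤-reflexive (sym (+-suc ∣ p ∣ ∣ q ∣)))
∣p∪q∣≤∣p∣+∣q∣ (false ∷ p) (false ∷ q) = ∣p∪q∣≤∣p∣+∣q∣ p q

∣p∣+∣q∣<n⇒∃x∉p∪q : ∀ {k} (p q : Subset k) → ∣ p ∣ + ∣ q ∣ < k → Σ (Fin k) λ x → x ∉ p × x ∉ q
∣p∣+∣q∣<n⇒∃x∉p∪q {k} p q ∣p∣+∣q∣<k =
  let x , x∉p∪q = ¬∀⟶∃¬ k (_∈ p ∪ q) (_∈? p ∪ q) p∪q≢⊤
  in  x , x∉p∪q ∘ x∈p∪q⁺ ∘ inj₁ , x∉p∪q ∘ x∈p∪q⁺ ∘ inj₂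
  where
  p∪q≢⊤ : ¬ (∀ x → x ∈ p ∪ q)
  p∪q≢⊤ all = <-irrefl refl (<-≤-trans ∣p∣+∣q∣<k (begin
    k             ≡⟨ sym (∣⊤∣≡n k) ⟩
    ∣ ⊤ {k} ∣     ≤⟨ p⊆q⇒∣p∣≤∣q∣ {p = ⊤} (λ {x} _ → all x) ⟩
    ∣ p ∪ q ∣     ≤⟨ ∣p∪q∣≤∣p∣+∣q∣ p q ⟩
    ∣ p ∣ + ∣ q ∣ ∎))
    where open ≤-Reasoning

∣p++q∣≡∣p∣+∣q∣ : ∀ {a b} (p : Subset a) (q : Subset b) → ∣ p ++ q ∣ ≡ ∣ p ∣ + ∣ q ∣
∣p++q∣≡∣p∣+∣q∣ []          q = refl
∣p++q∣≡∣p∣+∣q∣ (true  ∷ p) q = cong suc (∣p++q∣≡∣p∣+∣q∣ p q)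
∣p++q∣≡∣p∣+∣q∣ (false ∷ p) q = ∣p++q∣≡∣p∣+∣q∣ p q

∉-resp-lookup : ∀ {a b} {p : Subset a} {q : Subset b} {x y} → lookup p x ≡ lookup q y → x ∉ p → y ∉ q
∉-resp-lookup {p = p} {x = x} eq x∉p y∈q = x∉p (lookup⇒[]= x p (trans eq ([]=⇒lookup y∈q)))

NonBipartite : Graph → Set
NonBipartite G = ¬ BipartiteOn G (λ _ → Unit)

⌊≟⌋-sym : ∀ {k} (u v : Fin k) → ⌊ u ≟ᶠ v ⌋ ≡ ⌊ v ≟ᶠ u ⌋
⌊≟⌋-sym u v with u ≟ᶠ v | v ≟ᶠ u
... | yes _   | yes _   = refl
... | no  _   | no  _   = refl
... | yes u≡v | no  v≢u = ⊥-elim (v≢u (sym u≡v))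
... | no  u≢v | yes v≡u = ⊥-elim (u≢v (sym v≡u))

record FreeColouring (c : ℕ) (G : Graph) : Set where
  field
    colour        : Fin (n G) → Fin (n G) → Fin c
    colour-sym    : ∀ u v → Adj G u v → colour u v ≡ colour v u
    colour-proper : ∀ v u w → Adj G v u → Adj G v w → u ≢ w → colour v u ≢ colour v w
    free          : Fin (n G) → Fin c
    free-unused   : ∀ v u → Adj G v u → colour v u ≢ free v

edgeColourable⇒freeColouring : ∀ {c G} → EdgeColourable c G → FreeColouring (suc c) G
edgeColourable⇒freeColouring {c} (colour , colour-sym , colour-proper) = record
  { colour        = λ u v → inject₁ (colour u v)
  ; colour-sym    = λ u v u~v → cong inject₁ (colour-sym u v u~v)
  ; colour-proper = λ v u w v~u v~w u≢w → colour-proper v u w v~u v~w u≢w ∘ inject₁-injective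
  ; free          = λ _ → fromℕ c
  ; free-unused   = λ _ _ _ eq → fromℕ≢inject₁ (sym eq)
  }

-- A vertex x of the prism is read as splitAt (n G) x : Fin (n G) ⊎ Fin (n G); layer b is copy b of G.
module Prism (G : Graph) where

  private
    k = n G

  side : Bool → Fin k → Fin k ⊎ Fin k
  side false = inj₁
  side true  = inj₂

  sideAdj : Fin k ⊎ Fin k → Fin k ⊎ Fin k → Bool
  sideAdj (inj₁ u) (inj₁ v) = adj G u v
  sideAdj (inj₂ u) (inj₂ v) = adj G u v
  sideAdj (inj₁ u) (inj₂ v) = ⌊ u ≟ᶠ v ⌋
  sideAdj (inj₂ u) (inj₁ v) = ⌊ u ≟ᶠ v ⌋

  sideAdj-sym : ∀ x y → sideAdj x y ≡ sideAdj y x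
  sideAdj-sym (inj₁ u) (inj₁ v) = Graph.sym G u v
  sideAdj-sym (inj₂ u) (inj₂ v) = Graph.sym G u v
  sideAdj-sym (inj₁ u) (inj₂ v) = ⌊≟⌋-sym u v
  sideAdj-sym (inj₂ u) (inj₁ v) = ⌊≟⌋-sym u v

  sideAdj-irrefl : ∀ x → sideAdj x x ≡ false
  sideAdj-irrefl (inj₁ u) = irrefl G u
  sideAdj-irrefl (inj₂ u) = irrefl G u

  prism : Graph
  prism = record
    { n      = k + k
    ; adj    = λ x y → sideAdj (splitAt k x) (splitAt k y)
    ; sym    = λ x y → sideAdj-sym (splitAt k x) (splitAt k y)
    ; irrefl = λ x → sideAdj-irrefl (splitAt k x)
    }

  layer : Bool → Fin k → Fin (k + k)
  layer false u = u ↑ˡ k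
  layer true  u = k ↑ʳ u

  splitAt-layer : ∀ b u → splitAt k (layer b u) ≡ side b u
  splitAt-layer false u = splitAt-↑ˡ k u k
  splitAt-layer true  u = splitAt-↑ʳ k k u

  layer-view : ∀ x → Σ Bool λ b → Σ (Fin k) λ u → x ≡ layer b u
  layer-view x with splitAt k x | join-splitAt k k x
  ... | inj₁ u | eq = false , u , sym eq
  ... | inj₂ u | eq = true  , u , sym eq

  splitAt-injective : ∀ {x y} → splitAt k x ≡ splitAt k y → x ≡ y
  splitAt-injective {x} {y} eq =
    trans (sym (join-splitAt k k x)) (trans (cong (join k k) eq) (join-splitAt k k y))

  layer-≢ : ∀ b u v → layer b u ≢ layer (not b) v
  layer-≢ b u v eq =
    side-≢ b (trans (sym (splitAt-layer b u)) (trans (cong (splitAt k) eq) (splitAt-layer (not b) v)))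
    where
    side-≢ : ∀ b → side b u ≢ side (not b) v
    side-≢ false ()
    side-≢ true  ()

  adj-layer : ∀ b u v → adj prism (layer b u) (layer b v) ≡ adj G u v
  adj-layer false u v rewrite splitAt-layer false u | splitAt-layer false v = refl
  adj-layer true  u v rewrite splitAt-layer true  u | splitAt-layer true  v = refl

  adj-rung : ∀ b u v → adj prism (layer b u) (layer (not b) v) ≡ ⌊ u ≟ᶠ v ⌋
  adj-rung false u v rewrite splitAt-layer false u | splitAt-layer true  v = refl
  adj-rung true  u v rewrite splitAt-layer true  u | splitAt-layer false v = refl

  Adj-layer : ∀ b {u v} → Adj G u v → Adj prism (layer b u) (layer b v)
  Adj-layer b {u} {v} = subst T (sym (adj-layer b u v))

  Adj-rung : ∀ b u → Adj prism (layer b u) (layer (not b) u)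
  Adj-rung b u = subst T (sym (adj-rung b u u)) (fromWitness refl)

  degree-layer : ∀ b u → degree prism (layer b u) ≡ suc (degree G u)
  degree-layer false u = begin
    degree prism (layer false u)
      ≡⟨ count-↑ k _ ⟩
    count (adj prism (layer false u) ∘ layer false) + count (adj prism (layer false u) ∘ layer true)
      ≡⟨ cong₂ _+_ (count-cong (adj-layer false u)) (count-cong (adj-rung false u)) ⟩
    degree G u + count (λ v → ⌊ u ≟ᶠ v ⌋)
      ≡⟨ cong (degree G u +_) (count-≟ u) ⟩
    degree G u + 1
      ≡⟨ +-comm (degree G u) 1 ⟩
    suc (degree G u)
      ∎
    where open ≡-Reasoning
  degree-layer true u = begin
    degree prism (layer true u)
      ≡⟨ count-↑ k _ ⟩
    count (adj prism (layer true u) ∘ layer false) + count (adj prism (layer true u) ∘ layer true)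
      ≡⟨ cong₂ _+_ (count-cong (adj-rung true u)) (count-cong (adj-layer true u)) ⟩
    count (λ v → ⌊ u ≟ᶠ v ⌋) + degree G u
      ≡⟨ cong (_+ degree G u) (count-≟ u) ⟩
    suc (degree G u)
      ∎
    where open ≡-Reasoning

  prism-regular : ∀ {r} → Regular r G → Regular (suc r) prism
  prism-regular reg x with layer-view x
  ... | b , u , refl = trans (degree-layer b u) (cong suc (reg u))

  layer-bipartite : ∀ b {P} → (∀ u → P (layer b u)) → BipartiteOn prism P → BipartiteOn G (λ _ → Unit)
  layer-bipartite b P-layer (f , proper) =
    f ∘ layer b , λ u v _ _ u~v → proper _ _ (P-layer u) (P-layer v) (Adj-layer b u~v)

  prism-nonBipartite : NonBipartite G → NonBipartite prism
  prism-nonBipartite nb = nb ∘ layer-bipartite false _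

  prism-deleteNonBipartite : NonBipartite G → ∀ w → ¬ DeleteBipartite prism w
  prism-deleteNonBipartite nb w with layer-view w
  ... | b , u , refl = nb ∘ layer-bipartite (not b) (λ v eq → layer-≢ b u v (sym eq))

  module _ {c} (C : FreeColouring c G) where
    open FreeColouring C

    sideColour : Fin k ⊎ Fin k → Fin k ⊎ Fin k → Fin c
    sideColour (inj₁ u) (inj₁ v) = colour u v
    sideColour (inj₂ u) (inj₂ v) = colour u v
    sideColour (inj₁ u) (inj₂ v) = free u
    sideColour (inj₂ u) (inj₁ v) = free u

    sideColour-sym : ∀ x y → T (sideAdj x y) → sideColour x y ≡ sideColour y x
    sideColour-sym (inj₁ u) (inj₁ v) u~v = colour-sym u v u~v
    sideColour-sym (inj₂ u) (inj₂ v) u~v = colour-sym u v u~v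
    sideColour-sym (inj₁ u) (inj₂ v) u~v = cong free (toWitness u~v)
    sideColour-sym (inj₂ u) (inj₁ v) u~v = cong free (toWitness u~v)

    sideColour-proper : ∀ x y z → T (sideAdj x y) → T (sideAdj x z) → y ≢ z → sideColour x y ≢ sideColour x z
    sideColour-proper (inj₁ v) (inj₁ u) (inj₁ w) v~u v~w u≢w = colour-proper v u w v~u v~w (u≢w ∘ cong inj₁)
    sideColour-proper (inj₂ v) (inj₂ u) (inj₂ w) v~u v~w u≢w = colour-proper v u w v~u v~w (u≢w ∘ cong inj₂)
    sideColour-proper (inj₁ v) (inj₁ u) (inj₂ w) v~u _   _   = free-unused v u v~u
    sideColour-proper (inj₂ v) (inj₂ u) (inj₁ w) v~u _   _   = free-unused v u v~u
    sideColour-proper (inj₁ v) (inj₂ u) (inj₁ w) _   v~w _   = free-unused v w v~w ∘ sym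
    sideColour-proper (inj₂ v) (inj₁ u) (inj₂ w) _   v~w _   = free-unused v w v~w ∘ sym
    sideColour-proper (inj₁ v) (inj₂ u) (inj₂ w) v~u v~w u≢w =
      ⊥-elim (u≢w (cong inj₂ (trans (sym (toWitness v~u)) (toWitness v~w))))
    sideColour-proper (inj₂ v) (inj₁ u) (inj₁ w) v~u v~w u≢w =
      ⊥-elim (u≢w (cong inj₁ (trans (sym (toWitness v~u)) (toWitness v~w))))

    prism-edgeColourable : EdgeColourable c prism
    prism-edgeColourable =
        (λ x y → sideColour (splitAt k x) (splitAt k y))
      , (λ x y → sideColour-sym (splitAt k x) (splitAt k y))
      , (λ x y z x~y x~z y≢z → sideColour-proper (splitAt k x) (splitAt k y) (splitAt k z) x~y x~z
                                                 (y≢z ∘ splitAt-injective))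

  lookup-layer : ∀ b (S₀ S₁ : Subset k) u → lookup (S₀ ++ S₁) (layer b u) ≡ lookup (if b then S₁ else S₀) u
  lookup-layer false S₀ S₁ u = lookup-++ˡ S₀ S₁ u
  lookup-layer true  S₀ S₁ u = lookup-++ʳ S₀ S₁ u

  module Removal (S₀ S₁ : Subset k) where

    part : Bool → Subset k
    part b = if b then S₁ else S₀

    Alive : Fin (k + k) → Set
    Alive x = x ∉ S₀ ++ S₁

    ∉-layer : ∀ b {u} → u ∉ part b → Alive (layer b u)
    ∉-layer b {u} = ∉-resp-lookup (sym (lookup-layer b S₀ S₁ u))

    ∉-part : ∀ b {u} → Alive (layer b u) → u ∉ part b
    ∉-part b {u} = ∉-resp-lookup (lookup-layer b S₀ S₁ u)

    lift : ∀ b {u v} → Reach G (_∉ part b) u v → Reach prism Alive (layer b u) (layer b v)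
    lift b = Reach-map (layer b) (∉-layer b) (Adj-layer b)

    cross : ∀ b b′ u → Alive (layer b u) → Alive (layer b′ u) → Reach prism Alive (layer b u) (layer b′ u)
    cross false false u alive _     = here alive
    cross true  true  u alive _     = here alive
    cross false true  u alive alive′ = there alive (Adj-rung false u) (here alive′)
    cross true  false u alive alive′ = there alive (Adj-rung true u) (here alive′)

    connected-via-intact-layer : ∀ b → Fin k → ∣ part b ∣ ≡ 0 → ConnectedOn G (_∉ part b) →
                                 ConnectedOn prism Alive
    connected-via-intact-layer b h ∣part∣≡0 conn = ConnectedOn-hub (layer b h) reach
      where
      intact : ∀ u → u ∉ part b
      intact = ∣p∣≡0⇒x∉p ∣part∣≡0
      reach : ∀ x → Alive x → Reach prism Alive x (layer b h)
      reach x alive with layer-view x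
      ... | b′ , u , refl =
        Reach-trans (cross b′ b u alive (∉-layer b (intact u))) (lift b (conn u h (intact u) (intact h)))

    connected-via-rung : ∀ h → h ∉ S₀ → h ∉ S₁ → (∀ b → ConnectedOn G (_∉ part b)) → ConnectedOn prism Alive
    connected-via-rung h h∉S₀ h∉S₁ conn = ConnectedOn-hub (layer false h) reach
      where
      h∉part : ∀ b → h ∉ part b
      h∉part false = h∉S₀
      h∉part true  = h∉S₁
      reach : ∀ x → Alive x → Reach prism Alive x (layer false h)
      reach x alive with layer-view x
      ... | b , u , refl =
        Reach-trans (lift b (conn b u h (∉-part b alive) (h∉part b)))
                    (cross b false h (∉-layer b (h∉part b)) (∉-layer false h∉S₀))

  -- If one copy loses no vertex, every survivor reaches it, along its rung if need be.  Otherwise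
  -- each copy loses at most r vertices, and as |S| < k some rung survives whole and serves as hub.
  prism-kConnected : ∀ {r} → KConnected (suc r) G → KConnected (2 + r) prism
  prism-kConnected {r} (1+r<k , conn) = 2+r<k+k , connected
    where
    0<k : 0 < k
    0<k = ≤-<-trans z≤n 1+r<k

    2+r<k+k : 2 + r < k + k
    2+r<k+k = ≤-trans (s≤s 1+r<k) (≤-trans (≤-reflexive (+-comm 1 k)) (+-monoʳ-≤ k 0<k))

    h₀ : Fin k
    h₀ = fromℕ< 0<k

    conn-∅ : ∀ S → ∣ S ∣ ≡ 0 → ConnectedOn G (_∉ S)
    conn-∅ S ∣S∣≡0 = conn S (subst (_< suc r) (sym ∣S∣≡0) (s≤s z≤n))

    connected-split : ∀ S₀ S₁ → ∣ S₀ ∣ + ∣ S₁ ∣ ≤ suc r → ConnectedOn prism (_∉ S₀ ++ S₁)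
    connected-split S₀ S₁ ∣S∣≤1+r with ∣ S₀ ∣ <? suc r | ∣ S₁ ∣ <? suc r
    ... | yes ∣S₀∣≤r | yes ∣S₁∣≤r =
      let h , h∉S₀ , h∉S₁ = ∣p∣+∣q∣<n⇒∃x∉p∪q S₀ S₁ (≤-<-trans ∣S∣≤1+r 1+r<k)
      in  Removal.connected-via-rung S₀ S₁ h h∉S₀ h∉S₁ λ { false → conn S₀ ∣S₀∣≤r ; true → conn S₁ ∣S₁∣≤r }
    ... | no ∣S₀∣≮1+r | _ =
      let ∣S₁∣≡0 = m+n≤o≤m⇒n≡0 ∣S∣≤1+r (≮⇒≥ ∣S₀∣≮1+r)
      in  Removal.connected-via-intact-layer S₀ S₁ true h₀ ∣S₁∣≡0 (conn-∅ S₁ ∣S₁∣≡0)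
    ... | yes _ | no ∣S₁∣≮1+r =
      let ∣S₀∣≡0 = m+n≤o≤m⇒n≡0 (subst (_≤ suc r) (+-comm ∣ S₀ ∣ ∣ S₁ ∣) ∣S∣≤1+r) (≮⇒≥ ∣S₁∣≮1+r)
      in  Removal.connected-via-intact-layer S₀ S₁ false h₀ ∣S₀∣≡0 (conn-∅ S₀ ∣S₀∣≡0)

    connected : ∀ S → ∣ S ∣ < 2 + r → ConnectedOn prism (_∉ S)
    connected S ∣S∣<2+r with Vec.splitAt k S
    ... | S₀ , S₁ , refl = connected-split S₀ S₁ (subst (_≤ suc r) (∣p++q∣≡∣p∣+∣q∣ S₀ S₁) (≤-pred ∣S∣<2+r))

odd : ℕ → Bool
odd zero    = false
odd (suc i) = not (odd i)

odd-double : ∀ t → odd (t + t) ≡ false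
odd-double zero    = refl
odd-double (suc t) rewrite +-suc t t | odd-double t = refl

module OddCycle (t : ℕ) where

  ℓ : ℕ
  ℓ = suc (suc (t + t))

  m : ℕ
  m = suc ℓ

  data Step : ℕ → ℕ → Set where
    next : ∀ {i} → Step i (suc i)
    wrap : Step ℓ 0

  Step? : ∀ i j → Dec (Step i j)
  Step? i j with j ℕ.≟ suc i | i ℕ.≟ ℓ | j ℕ.≟ 0
  ... | yes refl | _        | _        = yes next
  ... | no  _    | yes refl | yes refl = yes wrap
  ... | no  ¬nxt | yes _    | no  j≢0  = no λ { next → ¬nxt refl ; wrap → j≢0 refl }
  ... | no  ¬nxt | no  i≢ℓ  | _        = no λ { next → ¬nxt refl ; wrap → i≢ℓ refl }

  Step-irrefl : ∀ {i} → ¬ Step i i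
  Step-irrefl ()

  Step-asym : ∀ {i j} → Step i j → ¬ Step j i
  Step-asym next ()
  Step-asym wrap ()

  Step-irrelevant : ∀ {i j} (s s′ : Step i j) → s ≡ s′
  Step-irrelevant next next = refl
  Step-irrelevant wrap wrap = refl

  successor-unique : ∀ {i j j′} → Step i j → Step i j′ → j < m → j′ < m → j ≡ j′
  successor-unique next next _   _    = refl
  successor-unique wrap wrap _   _    = refl
  successor-unique next wrap j<m _    = ⊥-elim (<-irrefl refl j<m)
  successor-unique wrap next _   j′<m = ⊥-elim (<-irrefl refl j′<m)

  predecessor-unique : ∀ {i i′ j} → Step i j → Step i′ j → i ≡ i′
  predecessor-unique next next = refl
  predecessor-unique wrap wrap = refl

  successor : ∀ i → i < m → Σ ℕ λ j → j < m × Step i j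
  successor i (s≤s i≤ℓ) with i ℕ.≟ ℓ
  ... | yes refl = 0 , s≤s z≤n , wrap
  ... | no  i≢ℓ  = suc i , s≤s (≤∧≢⇒< i≤ℓ i≢ℓ) , next

  predecessor : ∀ j → j < m → Σ ℕ λ i → i < m × Step i j
  predecessor zero    _         = ℓ , ≤-refl , wrap
  predecessor (suc i) (s≤s i<ℓ) = i , ≤-trans i<ℓ (n≤1+n ℓ) , next

  cycleAdj : ℕ → ℕ → Bool
  cycleAdj i j = ⌊ Step? i j ⌋ ∨ ⌊ Step? j i ⌋

  cycle : Graph
  cycle = record
    { n      = m
    ; adj    = λ u v → cycleAdj (toℕ u) (toℕ v)
    ; sym    = λ u v → ∨-comm ⌊ Step? (toℕ u) (toℕ v) ⌋ ⌊ Step? (toℕ v) (toℕ u) ⌋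
    ; irrefl = λ u → let ¬step = trans (isYes≗does _) (dec-false (Step? (toℕ u) (toℕ u)) Step-irrefl)
                     in  cong₂ _∨_ ¬step ¬step
    }

  Adj⇒Step : ∀ {u v} → Adj cycle u v → Step (toℕ u) (toℕ v) ⊎ Step (toℕ v) (toℕ u)
  Adj⇒Step {u} {v} = Sum.map toWitness toWitness ∘ Equivalence.to (T-∨ {⌊ Step? (toℕ u) (toℕ v) ⌋})

  Step⇒Adj : ∀ {u v} → Step (toℕ u) (toℕ v) → Adj cycle u v
  Step⇒Adj {u} {v} s = Equivalence.from (T-∨ {⌊ Step? (toℕ u) (toℕ v) ⌋}) (inj₁ (fromWitness s))

  Step˘⇒Adj : ∀ {u v} → Step (toℕ v) (toℕ u) → Adj cycle u v
  Step˘⇒Adj {u} {v} s = Equivalence.from (T-∨ {⌊ Step? (toℕ u) (toℕ v) ⌋}) (inj₂ (fromWitness s))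

  cycle-regular : Regular 2 cycle
  cycle-regular u = begin
    degree cycle u
      ≡⟨ count-∨ {m} (λ v → ⌊ Step? i (toℕ v) ⌋) (λ v → ⌊ Step? (toℕ v) i ⌋) disjoint ⟩
    count {m} (λ v → ⌊ Step? i (toℕ v) ⌋) + count {m} (λ v → ⌊ Step? (toℕ v) i ⌋)
      ≡⟨ cong₂ _+_ one-successor one-predecessor ⟩
    2
      ∎
    where
    open ≡-Reasoning
    i = toℕ u
    disjoint : ∀ v → T ⌊ Step? i (toℕ v) ⌋ → ¬ T ⌊ Step? (toℕ v) i ⌋
    disjoint v s s˘ = Step-asym (toWitness s) (toWitness s˘)
    one-successor : count {m} (λ v → ⌊ Step? i (toℕ v) ⌋) ≡ 1
    one-successor =
      let j , j<m , s = successor i (toℕ<n u)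
      in  count-unique-toℕ (Step? i) j j<m s (λ j′ j′<m s′ → successor-unique s′ s j′<m j<m)
    one-predecessor : count {m} (λ v → ⌊ Step? (toℕ v) i ⌋) ≡ 1
    one-predecessor =
      let h , h<m , s = predecessor i (toℕ<n u)
      in  count-unique-toℕ (λ h → Step? h i) h h<m s (λ h′ _ s′ → predecessor-unique s′ s)

  walk : ∀ {P} {u v : Fin m} → toℕ u ≤ toℕ v → (∀ x → toℕ u ≤ toℕ x → toℕ x ≤ toℕ v → P x) →
         Reach cycle P u v
  walk {P} {u} {v} u≤v = ascend (toℕ v ∸ toℕ u) (sym (m∸n+n≡m u≤v))
    where
    ascend : ∀ d {u v : Fin m} → toℕ v ≡ d + toℕ u →
             (∀ x → toℕ u ≤ toℕ x → toℕ x ≤ toℕ v → P x) → Reach cycle P u v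
    ascend zero {u} v≡u inside =
      subst (Reach cycle P u) (toℕ-injective (sym v≡u)) (here (inside u ≤-refl (≤-reflexive (sym v≡u))))
    ascend (suc d) {u} {v} v≡1+d+u inside =
      there (inside u ≤-refl (≤-trans (n≤1+n _) 1+u≤v)) (Step⇒Adj (subst (Step (toℕ u)) (sym toℕ-u′) next))
            (ascend d v≡d+u′ λ x u′≤x → inside x (≤-trans (n≤1+n _) (subst (_≤ toℕ x) toℕ-u′ u′≤x)))
      where
      1+u≤v : suc (toℕ u) ≤ toℕ v
      1+u≤v = subst (suc (toℕ u) ≤_) (sym v≡1+d+u) (s≤s (m≤n+m (toℕ u) d))
      u′ : Fin m
      u′ = fromℕ< (≤-<-trans 1+u≤v (toℕ<n v))
      toℕ-u′ : toℕ u′ ≡ suc (toℕ u)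
      toℕ-u′ = toℕ-fromℕ< (≤-<-trans 1+u≤v (toℕ<n v))
      v≡d+u′ : toℕ v ≡ d + toℕ u′
      v≡d+u′ = trans v≡1+d+u (trans (sym (+-suc d (toℕ u))) (cong (d +_) (sym toℕ-u′)))

  t<m : t < m
  t<m = s≤s (≤-trans (m≤m+n t t) (≤-trans (n≤1+n _) (n≤1+n _)))

  last : Fin m
  last = fromℕ< (n<1+n ℓ)

  wrap-last : Step (toℕ last) 0
  wrap-last = subst (λ i → Step i 0) (sym (toℕ-fromℕ< (n<1+n ℓ))) wrap

  -- Deleting s leaves the path s+1, …, ℓ, 0, …, s−1: survivors on the same side of s are joined
  -- by walking along the indices, survivors on opposite sides by going round through ℓ — 0.
  module _ (s : Fin m) where

    private
      below : ∀ {u v} → toℕ v < toℕ s → toℕ u ≤ toℕ v → Reach cycle (_≢ s) u v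
      below v<s u≤v = walk u≤v λ x _ x≤v x≡s → <-irrefl (cong toℕ x≡s) (≤-<-trans x≤v v<s)

      above : ∀ {u v} → toℕ s < toℕ u → toℕ u ≤ toℕ v → Reach cycle (_≢ s) u v
      above s<u u≤v = walk u≤v λ x u≤x _ x≡s → <-irrefl (cong toℕ (sym x≡s)) (<-≤-trans s<u u≤x)

      around : ∀ {u v} → toℕ u < toℕ s → toℕ s < toℕ v → Reach cycle (_≢ s) u v
      around {u} {v} u<s s<v =
        Reach-trans (Reach-sym (below u<s z≤n)) (there 0≢s (Step˘⇒Adj wrap-last) (Reach-sym (above s<v v≤ℓ)))
        where
        0≢s : zero ≢ s
        0≢s 0≡s = <-irrefl (cong toℕ 0≡s) (≤-<-trans z≤n u<s)
        v≤ℓ : toℕ v ≤ toℕ last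
        v≤ℓ = subst (toℕ v ≤_) (sym (toℕ-fromℕ< (n<1+n ℓ))) (≤-pred (toℕ<n v))

      ordered : ∀ u v → toℕ u ≤ toℕ v → u ≢ s → v ≢ s → Reach cycle (_≢ s) u v
      ordered u v u≤v u≢s v≢s with toℕ v <? toℕ s | toℕ s <? toℕ u
      ... | yes v<s | _       = below v<s u≤v
      ... | no  _   | yes s<u = above s<u u≤v
      ... | no  v≮s | no  s≮u =
        around (≤∧≢⇒< (≮⇒≥ s≮u) (u≢s ∘ toℕ-injective)) (≤∧≢⇒< (≮⇒≥ v≮s) (v≢s ∘ toℕ-injective ∘ sym))

    cycle-minus-connected : ConnectedOn cycle (_≢ s)
    cycle-minus-connected u v u≢s v≢s with ≤-total (toℕ u) (toℕ v)
    ... | inj₁ u≤v = ordered u v u≤v u≢s v≢s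
    ... | inj₂ v≤u = Reach-sym (ordered v u v≤u v≢s u≢s)

  cycle-kConnected : KConnected 2 cycle
  cycle-kConnected = s≤s (s≤s (s≤s z≤n)) , connected
    where
    connected : ∀ S → ∣ S ∣ < 2 → ConnectedOn cycle (_∉ S)
    connected S (s≤s ∣S∣≤1) with nonempty? S
    ... | no empty = ConnectedOn-hub zero λ x _ → Reach-sym (walk z≤n λ y _ _ y∈S → empty (y , y∈S))
    ... | yes (s , s∈S) = λ u v u∉S v∉S →
      Reach-map id (∣p∣≤1∧x∈p∧y≢x⇒y∉p ∣S∣≤1 s∈S) id (cycle-minus-connected s u v (≢s u∉S) (≢s v∉S))
      where
      ≢s : ∀ {x} → x ∉ S → x ≢ s
      ≢s x∉S refl = x∉S s∈S

  odd-ℓ : odd ℓ ≡ false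
  odd-ℓ = trans (not-involutive _) (odd-double t)

  cycle-nonBipartite : NonBipartite cycle
  cycle-nonBipartite (f , proper) =
    proper last zero tt tt (Step⇒Adj wrap-last) (trans (alternate ℓ (n<1+n ℓ)) (cong flipIf odd-ℓ))
    where
    flipIf : Bool → Bool
    flipIf b = if b then not (f zero) else f zero

    not-flipIf : ∀ b → not (flipIf b) ≡ flipIf (not b)
    not-flipIf false = refl
    not-flipIf true  = not-involutive (f zero)

    alternate : ∀ i (i<m : i < m) → f (fromℕ< i<m) ≡ flipIf (odd i)
    alternate zero    _     = refl
    alternate (suc i) 1+i<m = begin
      f (fromℕ< 1+i<m)     ≡⟨ ¬-not (proper _ _ tt tt (Step˘⇒Adj step)) ⟩
      not (f (fromℕ< i<m)) ≡⟨ cong not (alternate i i<m) ⟩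
      not (flipIf (odd i)) ≡⟨ not-flipIf (odd i) ⟩
      flipIf (odd (suc i)) ∎
      where
      open ≡-Reasoning
      i<m : i < m
      i<m = ≤-trans (n≤1+n _) 1+i<m
      step : Step (toℕ (fromℕ< i<m)) (toℕ (fromℕ< 1+i<m))
      step = subst₂ Step (sym (toℕ-fromℕ< i<m)) (sym (toℕ-fromℕ< 1+i<m)) next

  -- Path edges i → i+1 alternate between colours 0 and 1 and the edge ℓ → 0 gets colour 2.  As ℓ
  -- is even, vertex 0 misses colour 1, vertex ℓ misses colour 0 and every other vertex misses 2.
  parityColour : Bool → Fin 3
  parityColour false = zero
  parityColour true  = suc zero

  wrapColour : Fin 3
  wrapColour = suc (suc zero)

  parityColour≢wrapColour : ∀ b → parityColour b ≢ wrapColour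
  parityColour≢wrapColour false ()
  parityColour≢wrapColour true  ()

  parityColour-not : ∀ b → parityColour b ≢ parityColour (not b)
  parityColour-not false ()
  parityColour-not true  ()

  stepColour : ∀ {i j} → Step i j → Fin 3
  stepColour (next {i}) = parityColour (odd i)
  stepColour wrap       = wrapColour

  stepColour-consecutive : ∀ {h i j} (s : Step h i) (s′ : Step i j) → stepColour s ≢ stepColour s′
  stepColour-consecutive (next {h}) next = parityColour-not (odd h)
  stepColour-consecutive next       wrap = parityColour≢wrapColour _
  stepColour-consecutive wrap       next = parityColour≢wrapColour false ∘ sym

  freeColour : ℕ → Fin 3
  freeColour zero = parityColour true
  freeColour (suc i) with suc i ℕ.≟ ℓ
  ... | yes _ = parityColour false
  ... | no  _ = wrapColour

  stepColour≢freeColour-source : ∀ {i j} (s : Step i j) → j < m → stepColour s ≢ freeColour i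
  stepColour≢freeColour-source (next {zero})  _   = λ ()
  stepColour≢freeColour-source (next {suc i}) j<m with suc i ℕ.≟ ℓ
  ... | yes refl = ⊥-elim (<-irrefl refl j<m)
  ... | no  _    = parityColour≢wrapColour _
  stepColour≢freeColour-source wrap _ with ℓ ℕ.≟ ℓ
  ... | yes _  = λ ()
  ... | no ℓ≢ℓ = ⊥-elim (ℓ≢ℓ refl)

  stepColour≢freeColour-target : ∀ {i j} (s : Step i j) → stepColour s ≢ freeColour j
  stepColour≢freeColour-target (next {i}) with suc i ℕ.≟ ℓ
  ... | yes refl rewrite odd-double t = λ ()
  ... | no  _    = parityColour≢wrapColour _
  stepColour≢freeColour-target wrap = λ ()

  colourAt : ℕ → ℕ → Fin 3
  colourAt i j with Step? i j | Step? j i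
  ... | yes s | _     = stepColour s
  ... | no  _ | yes s = stepColour s
  ... | no  _ | no  _ = zero

  colourAt-step : ∀ {i j} (s : Step i j) → colourAt i j ≡ stepColour s
  colourAt-step {i} {j} s with Step? i j
  ... | yes s′ = cong stepColour (Step-irrelevant s′ s)
  ... | no  ¬s = ⊥-elim (¬s s)

  colourAt-step˘ : ∀ {i j} (s : Step j i) → colourAt i j ≡ stepColour s
  colourAt-step˘ {i} {j} s with Step? i j | Step? j i
  ... | yes s˘ | _      = ⊥-elim (Step-asym s s˘)
  ... | no  _  | yes s′ = cong stepColour (Step-irrelevant s′ s)
  ... | no  _  | no  ¬s = ⊥-elim (¬s s)

  colourAt-proper : ∀ v u w → Adj cycle v u → Adj cycle v w → u ≢ w →
                    colourAt (toℕ v) (toℕ u) ≢ colourAt (toℕ v) (toℕ w)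
  colourAt-proper v u w v~u v~w u≢w with Adj⇒Step {v} {u} v~u | Adj⇒Step {v} {w} v~w
  ... | inj₁ s | inj₁ s′ = ⊥-elim (u≢w (toℕ-injective (successor-unique s s′ (toℕ<n u) (toℕ<n w))))
  ... | inj₂ s | inj₂ s′ = ⊥-elim (u≢w (toℕ-injective (predecessor-unique s s′)))
  ... | inj₁ s | inj₂ s′ = λ eq →
    stepColour-consecutive s′ s (sym (trans (sym (colourAt-step s)) (trans eq (colourAt-step˘ s′))))
  ... | inj₂ s | inj₁ s′ = λ eq →
    stepColour-consecutive s s′ (trans (sym (colourAt-step˘ s)) (trans eq (colourAt-step s′)))

  cycle-freeColouring : FreeColouring 3 cycle
  cycle-freeColouring = record
    { colour        = λ u v → colourAt (toℕ u) (toℕ v)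
    ; colour-sym    = colour-sym
    ; colour-proper = colourAt-proper
    ; free          = freeColour ∘ toℕ
    ; free-unused   = free-unused
    }
    where
    colour-sym : ∀ u v → Adj cycle u v → colourAt (toℕ u) (toℕ v) ≡ colourAt (toℕ v) (toℕ u)
    colour-sym u v u~v with Adj⇒Step {u} {v} u~v
    ... | inj₁ s = trans (colourAt-step s) (sym (colourAt-step˘ s))
    ... | inj₂ s = trans (colourAt-step˘ s) (sym (colourAt-step s))

    free-unused : ∀ v u → Adj cycle v u → colourAt (toℕ v) (toℕ u) ≢ freeColour (toℕ v)
    free-unused v u v~u with Adj⇒Step {v} {u} v~u
    ... | inj₁ s = subst (_≢ freeColour (toℕ v)) (sym (colourAt-step s))
                         (stepColour≢freeColour-source s (toℕ<n u))
    ... | inj₂ s = subst (_≢ freeColour (toℕ v)) (sym (colourAt-step˘ s)) (stepColour≢freeColour-target s)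

maxFin-const : ∀ {k} (f : Fin k → ℕ) {r} → 0 < k → (∀ i → f i ≡ r) → maxFin f ≡ r
maxFin-const {suc zero}    f _ f≡r = trans (cong (_⊔ 0) (f≡r zero)) (⊔-identityʳ _)
maxFin-const {suc (suc k)} f _ f≡r =
  trans (cong₂ _⊔_ (f≡r zero) (maxFin-const (f ∘ suc) (s≤s z≤n) (f≡r ∘ suc))) (⊔-idem _)

regular⇒maxDegree : ∀ {r G} → Regular r G → 0 < n G → maxDegree G ≡ r
regular⇒maxDegree {G = G} reg 0<n = maxFin-const (degree G) 0<n reg

record PrismSeed (r : ℕ) (G : Graph) : Set where
  field
    kConnected    : KConnected r G
    regular       : Regular r G
    freeColouring : FreeColouring (suc r) G
    nonBipartite  : NonBipartite G

module _ {r G} (seed : PrismSeed (suc r) G) where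
  open PrismSeed seed
  open Prism G

  prism-class1 : Class1 prism
  prism-class1 = subst (λ c → EdgeColourable c prism) (sym Δ≡2+r) (prism-edgeColourable freeColouring)
    where
    Δ≡2+r : maxDegree prism ≡ 2 + r
    Δ≡2+r = regular⇒maxDegree {G = prism} (prism-regular regular)
                              (≤-<-trans z≤n (proj₁ (prism-kConnected kConnected)))

  prism-InΦ* : InΦ* (2 + r) prism
  prism-InΦ* =
    (prism-kConnected kConnected , prism-regular regular , prism-class1) , prism-deleteNonBipartite nonBipartite

  prism-PrismSeed : PrismSeed (2 + r) prism
  prism-PrismSeed = record
    { kConnected    = prism-kConnected kConnected
    ; regular       = prism-regular regular
    ; freeColouring = edgeColourable⇒freeColouring (prism-edgeColourable freeColouring)
    ; nonBipartite  = prism-nonBipartite nonBipartite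
    }

cycle-PrismSeed : ∀ t → PrismSeed 2 (OddCycle.cycle t)
cycle-PrismSeed t = record
  { kConnected    = cycle-kConnected
  ; regular       = cycle-regular
  ; freeColouring = cycle-freeColouring
  ; nonBipartite  = cycle-nonBipartite
  }
  where open OddCycle t

large-PrismSeed : ∀ N d → Σ Graph λ G → N < n G × PrismSeed (2 + d) G
large-PrismSeed N zero    = OddCycle.cycle N , OddCycle.t<m N , cycle-PrismSeed N
large-PrismSeed N (suc d) =
  let G , N<n , seed = large-PrismSeed N d
  in  Prism.prism G , ≤-trans N<n (m≤m+n (n G) (n G)) , prism-PrismSeed seed

lemma5p7 : ∀ (r : ℕ) → 3 ≤ r → ∀ (N : ℕ) → Σ Graph (λ G → (N < n G) × InΦ* r G)
lemma5p7 (suc (suc (suc d))) (s≤s (s≤s (s≤s z≤n))) N =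
  let G , N<n , seed = large-PrismSeed N d
  in  Prism.prism G , ≤-trans N<n (m≤m+n (n G) (n G)) , prism-InΦ* seed
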